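{- For every integer $n\ge0$, $\mathbf{E}^+_n = (\mathbf{E}^+_n)^{\Gamma_k\text{ - }\mathrm{sh},k-n,0}$; that is, for every $f\in E[[X^{1/p^n}]]$, all $x,y\in\mathbf{Z}_p$ and all integers $i\ge0$ with $\operatorname{val}_p(x-y)\ge i$, one has $\operatorname{val}_X\big((1+p^kx)\cdot f-(1+p^ky)\cdot f\big)\ge p^{k-n}p^i$.
   Context: $E$ is a field of characteristic $p$, $\mathbf{E}^+_n=E[[X^{1/p^n}]]$ with $X$-adic valuation $\operatorname{val}_X$ ($\operatorname{val}_X(X^{1/p^n})=1/p^n$). $\mathbf{Z}_p^\times$ acts on $\mathbf{E}^+_n$ by continuous $E$-algebra automorphisms determined by $a\cdot X^{1/p^n}=(1+X^{1/p^n})^a-1$. $k\ge1$ ($k\ge2$ if $p=2$), $\Gamma_k=1+p^k\mathbf{Z}_p$ with coordinate $c(1+p^ka)=a$. -}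

module Defs where

open import Level using (Level; _⊔_)
open import Algebra.Bundles using (CommutativeRing)
open import Data.Nat as ℕ using (ℕ; zero; suc; _^_; _<_; _≡ᵇ_; NonZero)
open import Data.Nat.Properties using (m^n≢0)
open import Data.Nat.DivMod using (_%_)
open import Data.Nat.Combinatorics using (_C_)
open import Data.Nat.Primality using (Prime)
open import Data.Integer as ℤ using (ℤ; +_; -[1+_])
open import Data.Rational.Unnormalised as ℚ using (ℚᵘ)
open import Data.Bool using (if_then_else_)
open import Data.Product using (Σ)
open import Relation.Nullary using (¬_)
open import Relation.Binary.PropositionalEquality using (_≡_)

record IsField {c ℓ : Level} (R : CommutativeRing c ℓ) : Set (c ⊔ ℓ) where
  open CommutativeRing R
  field
    1≉0 : ¬ (1# ≈ 0#)
    inverse : ∀ x → ¬ (x ≈ 0#) → Σ Carrier (λ y → x * y ≈ 1#)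

module _ {c ℓ : Level} (R : CommutativeRing c ℓ) where
  open CommutativeRing R

  fromℕ : ℕ → Carrier
  fromℕ zero    = 0#
  fromℕ (suc n) = 1# + fromℕ n

  HasChar : ℕ → Set ℓ
  HasChar p = fromℕ p ≈ 0#

  -- Formal power series R[[T]] as coefficient sequences.  For E⁺ₙ we take
  -- T = X^{1/p^n}, so the coefficient of index m is that of X^{m/p^n}.

  Series : Set c
  Series = ℕ → Carrier

  sumBelow : ℕ → (ℕ → Carrier) → Carrier
  sumBelow zero    h = 0#
  sumBelow (suc m) h = sumBelow m h + h m

  oneS : Series
  oneS zero    = 1#
  oneS (suc _) = 0#

  mulS : Series → Series → Series
  mulS f g m = sumBelow (suc m) (λ j → f j * g (m ℕ.∸ j))

  powS : Series → ℕ → Series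
  powS g zero    = oneS
  powS g (suc l) = mulS g (powS g l)

  -- composition f(g(T)) for g with zero constant term
  compS : Series → Series → Series
  compS f g m = sumBelow (suc m) (λ l → f l * powS g l m)

  binomMinusOne : ℕ → Series
  binomMinusOne A zero    = 0#
  binomMinusOne A (suc j) = fromℕ (A C suc j)

  -- Action of a ∈ ℤ_p, given by its residues (a mod p^N)_N, on R[[T]]:
  --   a · f = f((1+T)^a - 1),
  -- where (1+T)^a is the T-adic limit of (1+T)^(a mod p^N).  In
  -- characteristic p, (1+T)^(a mod p^N) ≡ (1+T)^a mod T^(p^N), so the
  -- coefficient of T^m is computed with N = m+1 (p^(m+1) > m).
  actRes : (ℕ → ℕ) → Series → Series
  actRes a f m = compS f (binomMinusOne (a (suc m))) m

  subS : Series → Series → Series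
  subS f g m = f m + (- g m)

  ValXGe : (p n : ℕ) .{{_ : NonZero p}} → Series → ℚᵘ → Set ℓ
  ValXGe p n h r = ∀ m → (+ m ℚ./ (p ^ n)) {{m^n≢0 p n}} ℚ.< r → h m ≈ 0#

record ℤp (p : ℕ) .{{_ : NonZero p}} : Set where
  field
    res       : ℕ → ℕ
    res-bound : ∀ j → res j < p ^ j
    res-compat : ∀ j → (res (suc j) % (p ^ j)) {{m^n≢0 p j}} ≡ res j
open ℤp public

onePlusPowMul : (p k : ℕ) .{{_ : NonZero p}} → ℤp p → ℕ → ℕ
onePlusPowMul p k x j = ((1 ℕ.+ p ^ k ℕ.* res x j) % (p ^ j)) {{m^n≢0 p j}}

ValpDiffGe : (p : ℕ) .{{_ : NonZero p}} → ℤp p → ℤp p → ℕ → Set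
ValpDiffGe p x y i = res x i ≡ res y i

powℤ : (p : ℕ) .{{_ : NonZero p}} → ℤ → ℚᵘ
powℤ p (+ m)     = + (p ^ m) ℚ./ 1
powℤ p -[1+ m ]  = (+ 1 ℚ./ (p ^ suc m)) {{m^n≢0 p (suc m)}}

-- The coefficient of T^m in a · f only involves the images in E of the binomial
-- coefficients C(a, j), j ≤ m.  Since p ∣ C(p^N, j) for 0 < j < p^N, Pascal's rule
-- gives C(A + p^N, j) ≡ C(A, j) mod p for j < p^N, so these coefficients only depend
-- on a mod p^N once m < p^N.  If x ≡ y mod p^i then 1 + p^k x ≡ 1 + p^k y mod p^(k+i),
-- and val_X(T^m) = m / p^n < p^(k-n) p^i means m < p^(k+i); taking N = min(k+i, m+1),
-- the two actions agree on every coefficient below the claimed valuation.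

module Submission where

open import Defs
open import Level using (Level)
open import Algebra.Bundles using (CommutativeRing)
open import Data.Nat using (ℕ; zero; suc; NonZero)
open import Data.Nat.Primality using (Prime)

module Binomial where
  open import Data.Nat
  open import Data.Nat.Properties
  open import Data.Nat.Combinatorics
  open import Data.Nat.Divisibility
  open import Data.Nat.Primality
  open import Data.Sum using (inj₁; inj₂)
  open import Relation.Nullary using (¬_; yes; no; contradiction)
  open import Relation.Binary.PropositionalEquality
  open ≡-Reasoning

  [k+1]*[n+1]C[k+1]≡[n+1]*nCk : ∀ n k → suc k * (suc n C suc k) ≡ suc n * (n C k)
  [k+1]*[n+1]C[k+1]≡[n+1]*nCk zero    zero    = refl
  [k+1]*[n+1]C[k+1]≡[n+1]*nCk zero    (suc k) = *-zeroʳ (suc (suc k))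
  [k+1]*[n+1]C[k+1]≡[n+1]*nCk (suc n) zero    =
    trans (+-identityʳ _) (trans (nC1≡n (suc (suc n))) (sym (*-identityʳ (suc (suc n)))))
  [k+1]*[n+1]C[k+1]≡[n+1]*nCk (suc n) (suc k) = begin
      suc (suc k) * (suc (suc n) C suc (suc k))
    ≡⟨ cong (suc (suc k) *_) (nCk+nC[k+1]≡[n+1]C[k+1] (suc n) (suc k)) ⟨
      suc (suc k) * (a + b)
    ≡⟨ *-distribˡ-+ (suc (suc k)) a b ⟩
      (a + suc k * a) + suc (suc k) * b
    ≡⟨ cong₂ (λ u v → (a + u) + v) ([k+1]*[n+1]C[k+1]≡[n+1]*nCk n k) ([k+1]*[n+1]C[k+1]≡[n+1]*nCk n (suc k)) ⟩
      (a + suc n * (n C k)) + suc n * (n C suc k)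
    ≡⟨ +-assoc a _ _ ⟩
      a + (suc n * (n C k) + suc n * (n C suc k))
    ≡⟨ cong (a +_) (*-distribˡ-+ (suc n) (n C k) (n C suc k)) ⟨
      a + suc n * (n C k + n C suc k)
    ≡⟨ cong (λ c → a + suc n * c) (nCk+nC[k+1]≡[n+1]C[k+1] n k) ⟩
      suc (suc n) * a
    ∎
    where
    a = suc n C suc k
    b = suc n C suc (suc k)

  p^n∣m*o⇒p^n∣m : ∀ {p} → Prime p → ∀ {o} → ¬ p ∣ o → ∀ n m → p ^ n ∣ m * o → p ^ n ∣ m
  p^n∣m*o⇒p^n∣m pr p∤o zero    m _ = 1∣ m
  p^n∣m*o⇒p^n∣m {p} pr {o} p∤o (suc n) m p^[1+n]∣m*o
    with euclidsLemma m o pr (∣-trans (m∣m*n (p ^ n)) p^[1+n]∣m*o)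
  ... | inj₂ p∣o = contradiction p∣o p∤o
  ... | inj₁ (divides q refl) = subst (p * p ^ n ∣_) (*-comm p q) (*-monoʳ-∣ p p^n∣q)
    where
    instance _ = prime⇒nonZero pr
    p^n∣q : p ^ n ∣ q
    p^n∣q = p^n∣m*o⇒p^n∣m pr p∤o n q (*-cancelˡ-∣ p
      (subst (p * p ^ n ∣_) (trans (cong (_* o) (*-comm q p)) (*-assoc p q o)) p^[1+n]∣m*o))

  p∣[p^n]Ck : ∀ {p} → Prime p → ∀ n k → 0 < k → k < p ^ n → p ∣ p ^ n C k
  p∣[p^n]Ck {p} pr n (suc k) _ k<p^n with p ^ n in eq
  ... | suc m with p ∣? (suc m C suc k)
  ...   | yes p∣C = p∣C
  ...   | no p∤C = contradiction (∣⇒≤ p^n∣1+k) (<⇒≱ k<p^n)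
    where
    p^n∣1+k : suc m ∣ suc k
    p^n∣1+k = subst (_∣ suc k) eq (p^n∣m*o⇒p^n∣m pr p∤C n (suc k)
      (subst (_∣ suc k * (suc m C suc k)) (sym eq)
        (subst (suc m ∣_) (sym ([k+1]*[n+1]C[k+1]≡[n+1]*nCk m k)) (m∣m*n (m C k)))))

module ModPrimePower (p : ℕ) .{{_ : NonZero p}} where
  open import Data.Nat
  open import Data.Nat.Properties
  open import Data.Nat.DivMod
  open import Data.Nat.Divisibility
  open import Relation.Binary.PropositionalEquality
  open ≡-Reasoning

  p^-nonZero : ∀ e → NonZero (p ^ e)
  p^-nonZero e = m^n≢0 p e

  n<p^n : 1 < p → ∀ n → n < p ^ n
  n<p^n 1<p zero    = z<s
  n<p^n 1<p (suc n) = ≤-<-trans (n<p^n 1<p n)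
    (subst (_< p * p ^ n) (*-identityˡ (p ^ n)) (*-monoˡ-< (p ^ n) {{p^-nonZero n}} 1<p))

  m<p^a⇒m<p^b⇒m<p^[a⊓b] : ∀ {m} a b → m < p ^ a → m < p ^ b → m < p ^ (a ⊓ b)
  m<p^a⇒m<p^b⇒m<p^[a⊓b] a b m<p^a m<p^b =
    subst (_ <_) (sym (mono-≤-distrib-⊓ (^-monoʳ-≤ p) a b)) (⊓-glb m<p^a m<p^b)

  infixl 7 _%p^_
  _%p^_ : ℕ → ℕ → ℕ
  u %p^ e = (u % p ^ e) {{p^-nonZero e}}

  infix 4 _≡_[mod-p^_]
  _≡_[mod-p^_] : ℕ → ℕ → ℕ → Set
  u ≡ v [mod-p^ e ] = u %p^ e ≡ v %p^ e

  p^a∣p^b : ∀ {a b} → a ≤ b → p ^ a ∣ p ^ b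
  p^a∣p^b {a} {b} a≤b = divides (p ^ (b ∸ a))
    (trans (cong (p ^_) (sym (m∸n+n≡m a≤b))) (^-distribˡ-+-* p (b ∸ a) a))

  %p^-%p^ : ∀ u {a b} → a ≤ b → u %p^ b %p^ a ≡ u %p^ a
  %p^-%p^ u {a} {b} a≤b =
    m∣n⇒o%n%m≡o%m (p ^ a) (p ^ b) u {{p^-nonZero a}} {{p^-nonZero b}} (p^a∣p^b a≤b)

  mod-weaken : ∀ {a b u v} → a ≤ b → u ≡ v [mod-p^ b ] → u ≡ v [mod-p^ a ]
  mod-weaken {a} {b} {u} {v} a≤b u≡v = begin
    u %p^ a           ≡⟨ %p^-%p^ u a≤b ⟨
    u %p^ b %p^ a     ≡⟨ cong (_%p^ a) u≡v ⟩
    v %p^ b %p^ a     ≡⟨ %p^-%p^ v a≤b ⟩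
    v %p^ a           ∎

  +-congˡ-mod : ∀ {e u v} w → u ≡ v [mod-p^ e ] → w + u ≡ w + v [mod-p^ e ]
  +-congˡ-mod {e} {u} {v} w u≡v = begin
    (w + u) %p^ e               ≡⟨ %-distribˡ-+ w u (p ^ e) {{p^-nonZero e}} ⟩
    (w %p^ e + u %p^ e) %p^ e   ≡⟨ cong (λ z → (w %p^ e + z) %p^ e) u≡v ⟩
    (w %p^ e + v %p^ e) %p^ e   ≡⟨ %-distribˡ-+ w v (p ^ e) {{p^-nonZero e}} ⟨
    (w + v) %p^ e               ∎

  p^*-cong-mod : ∀ {e u v} k → u ≡ v [mod-p^ e ] → p ^ k * u ≡ p ^ k * v [mod-p^ e + k ]
  p^*-cong-mod {e} {u} {v} k u≡v = begin
    (p ^ k * u) %p^ (e + k)       ≡⟨ commute u ⟩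
    u * p ^ k % (p ^ e * p ^ k)   ≡⟨ m%n*o≡m*o%[n*o] u (p ^ e) (p ^ k) {{p^-nonZero e}} ⟨
    u %p^ e * p ^ k               ≡⟨ cong (_* p ^ k) u≡v ⟩
    v %p^ e * p ^ k               ≡⟨ m%n*o≡m*o%[n*o] v (p ^ e) (p ^ k) {{p^-nonZero e}} ⟩
    v * p ^ k % (p ^ e * p ^ k)   ≡⟨ commute v ⟨
    (p ^ k * v) %p^ (e + k)       ∎
    where
    instance
      p^e*p^k-nonZero : NonZero (p ^ e * p ^ k)
      p^e*p^k-nonZero = m*n≢0 (p ^ e) (p ^ k) {{p^-nonZero e}} {{p^-nonZero k}}
    commute : ∀ w → (p ^ k * w) %p^ (e + k) ≡ w * p ^ k % (p ^ e * p ^ k)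
    commute w = trans (cong (_%p^ (e + k)) (*-comm (p ^ k) w))
                      (%-congʳ {{p^-nonZero (e + k)}} (^-distribˡ-+-* p e k))

  res-≡-mod : ∀ (x : ℤp p) {a b} → a ≤ b → res x b ≡ res x a [mod-p^ a ]
  res-≡-mod x a≤b = go (≤⇒≤′ a≤b)
    where
    res-suc : ∀ b → res x (suc b) ≡ res x b [mod-p^ b ]
    res-suc b = trans (res-compat x b) (sym (m<n⇒m%n≡m {{p^-nonZero b}} (res-bound x b)))
    go : ∀ {a b} → a ≤′ b → res x b ≡ res x a [mod-p^ a ]
    go ≤′-refl = refl
    go {b = suc b} (≤′-step a≤′b) = trans (mod-weaken (≤′⇒≤ a≤′b) (res-suc b)) (go a≤′b)

  res-≡-mod-⊓ : ∀ (x y : ℤp p) {i} b → res x i ≡ res y i → res x b ≡ res y b [mod-p^ i ⊓ b ]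
  res-≡-mod-⊓ x y {i} b x≡y = begin
    res x b %p^ (i ⊓ b)         ≡⟨ res-≡-mod x (m⊓n≤n i b) ⟩
    res x (i ⊓ b) %p^ (i ⊓ b)   ≡⟨ res-≡-mod x (m⊓n≤m i b) ⟨
    res x i %p^ (i ⊓ b)         ≡⟨ cong (_%p^ (i ⊓ b)) x≡y ⟩
    res y i %p^ (i ⊓ b)         ≡⟨ res-≡-mod y (m⊓n≤m i b) ⟩
    res y (i ⊓ b) %p^ (i ⊓ b)   ≡⟨ res-≡-mod y (m⊓n≤n i b) ⟨
    res y b %p^ (i ⊓ b)         ∎

  onePlusPowMul-≡-mod : ∀ k (x y : ℤp p) {i b N} → res x i ≡ res y i → N ≤ b → N ≤ k + i →
    onePlusPowMul p k x b ≡ onePlusPowMul p k y b [mod-p^ N ]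
  onePlusPowMul-≡-mod k x y {i} {b} {N} x≡y N≤b N≤k+i = begin
    onePlusPowMul p k x b %p^ N     ≡⟨ %p^-%p^ (1 + p ^ k * res x b) N≤b ⟩
    (1 + p ^ k * res x b) %p^ N     ≡⟨ mod-weaken N≤i⊓b+k (+-congˡ-mod {i ⊓ b + k} 1 p^k*x≡p^k*y) ⟩
    (1 + p ^ k * res y b) %p^ N     ≡⟨ %p^-%p^ (1 + p ^ k * res y b) N≤b ⟨
    onePlusPowMul p k y b %p^ N     ∎
    where
    p^k*x≡p^k*y : p ^ k * res x b ≡ p ^ k * res y b [mod-p^ i ⊓ b + k ]
    p^k*x≡p^k*y = p^*-cong-mod {i ⊓ b} k (res-≡-mod-⊓ x y b x≡y)
    N≤i⊓b+k : N ≤ i ⊓ b + k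
    N≤i⊓b+k = subst (N ≤_) (trans (sym (+-distribˡ-⊓ k i b)) (+-comm k (i ⊓ b)))
                (⊓-glb N≤k+i (≤-trans N≤b (m≤n+m b k)))

module ValuationBound where
  open import Data.Nat as ℕ using (suc; _^_; _≤?_; _≤_; _<_)
  open import Data.Nat.Properties
  open import Data.Integer as ℤ using (+_; -[1+_])
  open import Data.Integer.Properties using (pos-*; drop‿+<+; m-n≡m⊖n; ⊖-≥; ⊖-<)
  open import Data.Rational.Unnormalised as ℚ using (_/_; *<*)
  open import Relation.Nullary using (yes; no)
  open import Algebra.Properties.CommutativeSemigroup *-commutativeSemigroup using (xy∙z≈xz∙y; x∙yz≈y∙xz)
  open import Relation.Binary.PropositionalEquality
  open ≡-Reasoning

  /-*-/ : ∀ a b D E .{{_ : NonZero D}} .{{_ : NonZero E}} →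
    (+ a / D) ℚ.* (+ b / E) ≡ (+ (a ℕ.* b) / (D ℕ.* E)) {{m*n≢0 D E}}
  /-*-/ a b (suc _) (suc _) = cong (λ c → c / _) (sym (pos-* a b))

  /-<-/⇒*<* : ∀ a b D E .{{_ : NonZero D}} .{{_ : NonZero E}} →
    (+ a / D) ℚ.< (+ b / E) → a ℕ.* E < b ℕ.* D
  /-<-/⇒*<* a b (suc d) (suc e) (*<* a*E<b*D) =
    drop‿+<+ (subst₂ ℤ._<_ (sym (pos-* a (suc e))) (sym (pos-* b (suc d))) a*E<b*D)

  module _ (p : ℕ) .{{_ : NonZero p}} (k n i m : ℕ) where

    private instance
      p^n-nonZero : NonZero (p ^ n)
      p^n-nonZero = m^n≢0 p n

    Below : ℚ.ℚᵘ → Set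
    Below r = (+ m / p ^ n) ℚ.< r ℚ.* (+ (p ^ i) / 1)

    below-p^-nonneg : n ≤ k → Below (powℤ p (+ k ℤ.- + n)) → m < p ^ (k ℕ.+ i)
    below-p^-nonneg n≤k m<r = subst₂ _<_ (*-identityʳ m) p^[k-n]*p^i*p^n≡p^[k+i]
      (/-<-/⇒*<* m _ (p ^ n) 1 (subst (λ r → + m / p ^ n ℚ.< r) (/-*-/ (p ^ (k ℕ.∸ n)) (p ^ i) 1 1)
         (subst (λ e → Below (powℤ p e)) (trans (m-n≡m⊖n k n) (⊖-≥ n≤k)) m<r)))
      where
      p^[k-n]*p^i*p^n≡p^[k+i] : p ^ (k ℕ.∸ n) ℕ.* p ^ i ℕ.* p ^ n ≡ p ^ (k ℕ.+ i)
      p^[k-n]*p^i*p^n≡p^[k+i] = begin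
        p ^ (k ℕ.∸ n) ℕ.* p ^ i ℕ.* p ^ n     ≡⟨ xy∙z≈xz∙y (p ^ (k ℕ.∸ n)) (p ^ i) (p ^ n) ⟩
        p ^ (k ℕ.∸ n) ℕ.* p ^ n ℕ.* p ^ i     ≡⟨ cong (ℕ._* p ^ i) (^-distribˡ-+-* p (k ℕ.∸ n) n) ⟨
        p ^ (k ℕ.∸ n ℕ.+ n) ℕ.* p ^ i         ≡⟨ cong (λ e → p ^ e ℕ.* p ^ i) (m∸n+n≡m n≤k) ⟩
        p ^ k ℕ.* p ^ i                       ≡⟨ ^-distribˡ-+-* p k i ⟨
        p ^ (k ℕ.+ i)                         ∎

    below-p^-neg : k < n → Below (powℤ p (+ k ℤ.- + n)) → m < p ^ (k ℕ.+ i)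
    below-p^-neg k<n m<r = *-cancelʳ-< (p ^ suc t) m (p ^ (k ℕ.+ i))
      (subst₂ _<_ (cong (m ℕ.*_) (*-identityʳ (p ^ suc t))) p^i*p^n≡p^[k+i]*p^[1+t]
        (/-<-/⇒*<* m (1 ℕ.* p ^ i) (p ^ n) (p ^ suc t ℕ.* 1)
          (subst (λ r → + m / p ^ n ℚ.< r) (/-*-/ 1 (p ^ i) (p ^ suc t) 1)
            (subst (λ e → Below (powℤ p e)) k-n≡-[1+t] m<r))))
      where
      t = n ℕ.∸ suc k
      instance
        p^[1+t]-nonZero : NonZero (p ^ suc t)
        p^[1+t]-nonZero = m^n≢0 p (suc t)
        p^[1+t]*1-nonZero : NonZero (p ^ suc t ℕ.* 1)
        p^[1+t]*1-nonZero = m*n≢0 (p ^ suc t) 1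
      n∸k≡1+t : n ℕ.∸ k ≡ suc t
      n∸k≡1+t = +-∸-assoc 1 k<n
      k-n≡-[1+t] : + k ℤ.- + n ≡ -[1+ t ]
      k-n≡-[1+t] = trans (m-n≡m⊖n k n) (trans (⊖-< k<n) (cong (λ d → ℤ.- + d) n∸k≡1+t))
      p^i*p^n≡p^[k+i]*p^[1+t] : 1 ℕ.* p ^ i ℕ.* p ^ n ≡ p ^ (k ℕ.+ i) ℕ.* p ^ suc t
      p^i*p^n≡p^[k+i]*p^[1+t] = begin
        1 ℕ.* p ^ i ℕ.* p ^ n                  ≡⟨ cong (ℕ._* p ^ n) (*-identityˡ (p ^ i)) ⟩
        p ^ i ℕ.* p ^ n                        ≡⟨ cong (λ e → p ^ i ℕ.* p ^ e) n≡k+[1+t] ⟩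
        p ^ i ℕ.* p ^ (k ℕ.+ suc t)            ≡⟨ cong (p ^ i ℕ.*_) (^-distribˡ-+-* p k (suc t)) ⟩
        p ^ i ℕ.* (p ^ k ℕ.* p ^ suc t)        ≡⟨ x∙yz≈y∙xz (p ^ i) (p ^ k) (p ^ suc t) ⟩
        p ^ k ℕ.* (p ^ i ℕ.* p ^ suc t)        ≡⟨ *-assoc (p ^ k) (p ^ i) (p ^ suc t) ⟨
        p ^ k ℕ.* p ^ i ℕ.* p ^ suc t          ≡⟨ cong (ℕ._* p ^ suc t) (^-distribˡ-+-* p k i) ⟨
        p ^ (k ℕ.+ i) ℕ.* p ^ suc t            ∎
        where
        n≡k+[1+t] : n ≡ k ℕ.+ suc t
        n≡k+[1+t] = trans (sym (m+[n∸m]≡n (<⇒≤ k<n))) (cong (k ℕ.+_) n∸k≡1+t)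

    below-p^ : Below (powℤ p (+ k ℤ.- + n)) → m < p ^ (k ℕ.+ i)
    below-p^ with n ≤? k
    ... | yes n≤k = below-p^-nonneg n≤k
    ... | no n≰k  = below-p^-neg (≰⇒> n≰k)

module SeriesCongruence {c ℓ : Level} (R : CommutativeRing c ℓ) where
  open import Data.Nat using (_≤_; _<_)
  open import Data.Nat.Properties using (≤-refl; ≤-trans; ≤-pred; m<n⇒m<1+n; m∸n≤m)
  open CommutativeRing R

  sumBelow-cong : ∀ M {h h′} → (∀ j → j < M → h j ≈ h′ j) → sumBelow R M h ≈ sumBelow R M h′
  sumBelow-cong zero    h≈h′ = refl
  sumBelow-cong (suc M) h≈h′ =
    +-cong (sumBelow-cong M (λ j j<M → h≈h′ j (m<n⇒m<1+n j<M))) (h≈h′ M ≤-refl)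

  powS-cong : ∀ {g g′} m → (∀ j → j ≤ m → g j ≈ g′ j) →
    ∀ l {m′} → m′ ≤ m → powS R g l m′ ≈ powS R g′ l m′
  powS-cong m g≈g′ zero    m′≤m = refl
  powS-cong m g≈g′ (suc l) {m′} m′≤m = sumBelow-cong (suc m′) (λ j j<1+m′ →
    *-cong (g≈g′ j (≤-trans (≤-pred j<1+m′) m′≤m))
           (powS-cong m g≈g′ l (≤-trans (m∸n≤m m′ j) m′≤m)))

  compS-cong : ∀ f {g g′} m → (∀ j → j ≤ m → g j ≈ g′ j) → compS R f g m ≈ compS R f g′ m
  compS-cong f m g≈g′ = sumBelow-cong (suc m) (λ l _ → *-congˡ (powS-cong m g≈g′ l ≤-refl))

module BinomialsModP {c ℓ : Level} (R : CommutativeRing c ℓ)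
  (p : ℕ) .{{_ : NonZero p}} (p-prime : Prime p) (char-p : HasChar R p) where
  open import Data.Nat as ℕ using (_≤_; _<_; _^_)
  import Data.Nat.Properties as ℕ
  open import Data.Nat.Combinatorics using (_C_; nCk+nC[k+1]≡[n+1]C[k+1])
  open import Data.Nat.Divisibility using (_∣_; divides)
  open import Data.Nat.DivMod using (_/_; m≡m%n+[m/n]*n)
  import Relation.Binary.PropositionalEquality as ≡
  open ≡ using (_≡_)
  open CommutativeRing R
  open import Algebra.Properties.Semiring.Mult semiring using (_×_; ×-homo-+; ×1-homo-*)
  open import Relation.Binary.Reasoning.Setoid setoid
  open Binomial using (p∣[p^n]Ck)
  open ModPrimePower p
  open SeriesCongruence R using (compS-cong)

  F : ℕ → Carrier
  F = fromℕ R

  F≈×1# : ∀ n → F n ≈ n × 1#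
  F≈×1# zero    = refl
  F≈×1# (suc n) = +-congˡ (F≈×1# n)

  F-homo-+ : ∀ a b → F (a ℕ.+ b) ≈ F a + F b
  F-homo-+ a b = trans (F≈×1# (a ℕ.+ b))
    (trans (×-homo-+ 1# a b) (sym (+-cong (F≈×1# a) (F≈×1# b))))

  F-homo-* : ∀ a b → F (a ℕ.* b) ≈ F a * F b
  F-homo-* a b = trans (F≈×1# (a ℕ.* b))
    (trans (×1-homo-* a b) (sym (*-cong (F≈×1# a) (F≈×1# b))))

  F-cong : ∀ {a b} → a ≡ b → F a ≈ F b
  F-cong ≡.refl = refl

  p∣n⇒F≈0 : ∀ {n} → p ∣ n → F n ≈ 0#
  p∣n⇒F≈0 (divides q ≡.refl) = trans (F-homo-* q p) (trans (*-congˡ char-p) (zeroʳ (F q)))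

  F-pascal : ∀ n k → F (suc n C suc k) ≈ F (n C k) + F (n C suc k)
  F-pascal n k = trans (F-cong (≡.sym (nCk+nC[k+1]≡[n+1]C[k+1] n k))) (F-homo-+ (n C k) (n C suc k))

  -- In characteristic p, (1 + T)^(p^N) = 1 + T^(p^N).
  F-C-+p^ : ∀ N a j → j < p ^ N → F ((a ℕ.+ p ^ N) C j) ≈ F (a C j)
  F-C-+p^ N zero    zero    _ = refl
  F-C-+p^ N zero    (suc j) j<p^N = p∣n⇒F≈0 (p∣[p^n]Ck p-prime N (suc j) (ℕ.s≤s ℕ.z≤n) j<p^N)
  F-C-+p^ N (suc a) zero    _ = refl
  F-C-+p^ N (suc a) (suc j) j<p^N = begin
    F (suc (a ℕ.+ p ^ N) C suc j)                      ≈⟨ F-pascal (a ℕ.+ p ^ N) j ⟩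
    F ((a ℕ.+ p ^ N) C j) + F ((a ℕ.+ p ^ N) C suc j)  ≈⟨ +-cong (F-C-+p^ N a j (ℕ.<-trans (ℕ.n<1+n j) j<p^N))
                                                                 (F-C-+p^ N a (suc j) j<p^N) ⟩
    F (a C j) + F (a C suc j)                          ≈⟨ F-pascal a j ⟨
    F (suc a C suc j)                                  ∎

  F-C-+*p^ : ∀ N q r j → j < p ^ N → F ((r ℕ.+ q ℕ.* p ^ N) C j) ≈ F (r C j)
  F-C-+*p^ N zero    r j j<p^N = F-cong (≡.cong (_C j) (ℕ.+-identityʳ r))
  F-C-+*p^ N (suc q) r j j<p^N = begin
    F ((r ℕ.+ (p ^ N ℕ.+ q ℕ.* p ^ N)) C j)  ≡⟨ ≡.cong (λ a → F (a C j)) regroup ⟩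
    F ((r ℕ.+ q ℕ.* p ^ N ℕ.+ p ^ N) C j)    ≈⟨ F-C-+p^ N (r ℕ.+ q ℕ.* p ^ N) j j<p^N ⟩
    F ((r ℕ.+ q ℕ.* p ^ N) C j)              ≈⟨ F-C-+*p^ N q r j j<p^N ⟩
    F (r C j)                                ∎
    where
    regroup : r ℕ.+ (p ^ N ℕ.+ q ℕ.* p ^ N) ≡ r ℕ.+ q ℕ.* p ^ N ℕ.+ p ^ N
    regroup = ≡.trans (≡.cong (r ℕ.+_) (ℕ.+-comm (p ^ N) (q ℕ.* p ^ N))) (≡.sym (ℕ.+-assoc r _ _))

  F-C-%p^ : ∀ N a j → j < p ^ N → F (a C j) ≈ F (a %p^ N C j)
  F-C-%p^ N a j j<p^N = trans (F-cong (≡.cong (_C j) (m≡m%n+[m/n]*n a (p ^ N) {{p^-nonZero N}})))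
    (F-C-+*p^ N ((a / p ^ N) {{p^-nonZero N}}) (a %p^ N) j j<p^N)

  F-C-cong-mod : ∀ N {a b} j → a ≡ b [mod-p^ N ] → j < p ^ N → F (a C j) ≈ F (b C j)
  F-C-cong-mod N {a} {b} j a≡b j<p^N = begin
    F (a C j)          ≈⟨ F-C-%p^ N a j j<p^N ⟩
    F (a %p^ N C j)    ≡⟨ ≡.cong (λ u → F (u C j)) a≡b ⟩
    F (b %p^ N C j)    ≈⟨ F-C-%p^ N b j j<p^N ⟨
    F (b C j)          ∎

  compS-binomMinusOne-cong : ∀ f N {A B} m → A ≡ B [mod-p^ N ] → m < p ^ N →
    compS R f (binomMinusOne R A) m ≈ compS R f (binomMinusOne R B) m
  compS-binomMinusOne-cong f N m A≡B m<p^N = compS-cong f m agree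
    where
    agree : ∀ j → j ≤ m → binomMinusOne R _ j ≈ binomMinusOne R _ j
    agree zero    _   = refl
    agree (suc j) j<m = F-C-cong-mod N (suc j) A≡B (ℕ.≤-<-trans j<m m<p^N)

open import Data.Nat as ℕ using (_≤_; _^_)
import Data.Nat.Properties as ℕ
open import Data.Nat.Primality using (prime⇒nonTrivial)
open import Data.Integer as ℤ using (+_)
open import Data.Rational.Unnormalised as ℚ using ()
open import Relation.Binary.PropositionalEquality using (_≡_)

proposition2p2 : {c ℓ : Level} (p : ℕ) .{{_ : NonZero p}} → Prime p →
    (R : CommutativeRing c ℓ) → IsField R → HasChar R p →
    (k : ℕ) → 1 ≤ k → (p ≡ 2 → 2 ≤ k) →
    (n : ℕ) (f : Series R) (x y : ℤp p) (i : ℕ) → ValpDiffGe p x y i →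
    ValXGe R p n
      (subS R (actRes R (onePlusPowMul p k x) f) (actRes R (onePlusPowMul p k y) f))
      (powℤ p (+ k ℤ.- + n) ℚ.* (+ (p ^ i) ℚ./ 1))
proposition2p2 p p-prime R _ char-p k _ _ n f x y i x≡y m m<val =
  trans (+-congʳ (compS-binomMinusOne-cong f N m A≡B m<p^N)) (-‿inverseʳ _)
  where
  open CommutativeRing R
  open BinomialsModP R p p-prime char-p
  open ModPrimePower p
  N : ℕ
  N = (k ℕ.+ i) ℕ.⊓ suc m
  A≡B : onePlusPowMul p k x (suc m) ≡ onePlusPowMul p k y (suc m) [mod-p^ N ]
  A≡B = onePlusPowMul-≡-mod k x y x≡y (ℕ.m⊓n≤n _ _) (ℕ.m⊓n≤m _ _)
  m<p^N : m ℕ.< p ^ N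
  m<p^N = m<p^a⇒m<p^b⇒m<p^[a⊓b] (k ℕ.+ i) (suc m) (ValuationBound.below-p^ p k n i m m<val)
    (ℕ.<-trans (ℕ.n<1+n m) (n<p^n (ℕ.nonTrivial⇒n>1 p {{prime⇒nonTrivial p-prime}}) (suc m)))
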